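{- Let $A$, $B$, $C$ be $m \times n$ matrices over $\{ -1,0,1\}$ such that $A$ has an entry $0$. If $(A,B,C)$ is left-$0$-invariant or right-$0$-invariant, then ${\rm IST}(A,B,C)=\infty$.
   Context: Rows of matrices are written as strings of length $n$; $x^r$ denotes the symbol $x$ repeated $r$ times. For an $m\times n$ matrix $M=[m_{ij}]$ over $\{ -1,0,1\}$, $G_o(M)$ is the directed graph on $\{1,\dots,n+m\}$ with edges $j\to i$ for all $1\le j<i\le n$, and for $1\le p\le m$, $1\le j\le n$: an edge $j\to n+p$ if $m_{pj}=1$, an edge $n+p\to j$ if $m_{pj}=-1$, no edge if $m_{pj}=0$; no edges among $n+1,\dots,n+m$. A directed graph is semi-transitive if it is acyclic and for every directed path $u_1\to\cdots\to u_t$, $t\ge2$, either there is no edge $u_1\to u_t$ or all edges $u_i\to u_j$ ($1\le i<j\le t$) exist. For $m\times n$ matrices $A,B,C$ over $\{ -1,0,1\}$, the morphism $\varphi$ replaces each entry $0,1,-1$ by the block $A,B,C$ respectively; $M^k(A,B,C)=\varphi^k([0])$ and $G_o^k(A,B,C)=G_o(M^k(A,B,C))$. If $A$ has an entry $0$, ${\rm IST}(A,B,C)$ is the least $\ell\ge0$ with $G_o^\ell(A,B,C)$ not semi-transitive, or $\infty$ if none exists. $(A,B,C)$ is left-$0$-invariant if: every row of $A$ is in $\{01^{n-1},1^n,0(-1)^{n-1},(-1)^n\}$; every row of $B$ and of $C$ is in $\{1^n,(-1)^n\}$; if $01^{n-1}$ is a row of $A$, then for every $i$, row $i$ of $B$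 is $1^n$ when row $i$ of $A$ is $01^{n-1}$ or $1^n$, and row $i$ of $B$ is $(-1)^n$ when row $i$ of $A$ is $0(-1)^{n-1}$ or $(-1)^n$; and if $0(-1)^{n-1}$ is a row of $A$, then the same implications hold with $C$ in place of $B$. $(A,B,C)$ is right-$0$-invariant if: every row of $A$ is in $\{1^{n-1}0,1^n,(-1)^{n-1}0,(-1)^n\}$; every row of $B$ and of $C$ is in $\{1^n,(-1)^n\}$; if $1^{n-1}0$ is a row of $A$, then for every $i$, row $i$ of $B$ is $1^n$ when row $i$ of $A$ is $1^{n-1}0$ or $1^n$, and row $i$ of $B$ is $(-1)^n$ when row $i$ of $A$ is $(-1)^{n-1}0$ or $(-1)^n$; and if $(-1)^{n-1}0$ is a row of $A$, then the same implications hold with $C$ in place of $B$. -}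

module Defs where

open import Data.Nat using (ℕ; zero; suc; _*_; _≡ᵇ_)
open import Data.Fin using (Fin; zero; suc; toℕ; inject₁; fromℕ; remQuot; _<_)
open import Data.Sum using (_⊎_; inj₁; inj₂)
open import Data.Product using (_×_; _,_; ∃; ∃-syntax)
open import Data.Bool using (if_then_else_)
open import Data.Empty using (⊥)
open import Relation.Nullary using (¬_)
open import Relation.Binary.PropositionalEquality using (_≡_; _≢_)

data Tri : Set where
  neg zer pos : Tri

-- an m × n matrix over {-1,0,1}: row index first, column index second
Matrix : ℕ → ℕ → Set
Matrix m n = Fin m → Fin n → Tri

zeroMat : Matrix 1 1
zeroMat _ _ = zer

-- the morphism φ: replace 0,1,-1 by the block A,B,C (row r = r₁·m + r₂)
block : ∀ {m n} → Matrix m n → Matrix m n → Matrix m n → Tri → Matrix m n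
block A B C zer = A
block A B C pos = B
block A B C neg = C

φ : ∀ {m n p q} → Matrix m n → Matrix m n → Matrix m n → Matrix p q → Matrix (p * m) (q * n)
φ {m} {n} A B C M r c with remQuot m r | remQuot n c
... | r₁ , r₂ | c₁ , c₂ = block A B C (M r₁ c₁) r₂ c₂

-- dimension b^k (written so that b^(k+1) = b^k * b)
pw : ℕ → ℕ → ℕ
pw b zero = 1
pw b (suc k) = pw b k * b

Mpow : ∀ {m n} → Matrix m n → Matrix m n → Matrix m n → (k : ℕ) → Matrix (pw m k) (pw n k)
Mpow A B C zero = zeroMat
Mpow A B C (suc k) = φ A B C (Mpow A B C k)

-- G_o(M) for an m × n matrix M.  Vertex inj₁ j stands for column vertex j+1 (1..n),
-- vertex inj₂ p for vertex n+p+1.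
Vertex : ℕ → ℕ → Set
Vertex m n = Fin n ⊎ Fin m

data GoEdge {m n : ℕ} (M : Matrix m n) : Vertex m n → Vertex m n → Set where
  colEdge  : ∀ {j i : Fin n} → j < i → GoEdge M (inj₁ j) (inj₁ i)
  upEdge   : ∀ {p : Fin m} {j : Fin n} → M p j ≡ pos → GoEdge M (inj₁ j) (inj₂ p)
  downEdge : ∀ {p : Fin m} {j : Fin n} → M p j ≡ neg → GoEdge M (inj₂ p) (inj₁ j)

-- directed paths u₀ → u₁ → ⋯ → u_{k+1}  (t = k+2 ≥ 2 vertices)
IsPath : ∀ {V : Set} → (V → V → Set) → (k : ℕ) → (Fin (suc (suc k)) → V) → Set
IsPath E k u = ∀ (i : Fin (suc k)) → E (u (inject₁ i)) (u (suc i))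

Acyclic : ∀ {V : Set} → (V → V → Set) → Set
Acyclic E = ∀ k u → IsPath E k u → ¬ (u zero ≡ u (fromℕ (suc k)))

SemiTransitive : ∀ {V : Set} → (V → V → Set) → Set
SemiTransitive E =
  Acyclic E ×
  (∀ k u → IsPath E k u →
     ¬ E (u zero) (u (fromℕ (suc k))) ⊎ (∀ (i j : Fin (suc (suc k))) → i < j → E (u i) (u j)))

GoPowST : ∀ {m n} → Matrix m n → Matrix m n → Matrix m n → ℕ → Set
GoPowST A B C k = SemiTransitive (GoEdge (Mpow A B C k))

ISTinfinite : ∀ {m n} → Matrix m n → Matrix m n → Matrix m n → Set
ISTinfinite A B C = ∀ k → GoPowST A B C k

HasZero : ∀ {m n} → Matrix m n → Set
HasZero A = ∃[ i ] ∃[ j ] A i j ≡ zer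

constRow : ∀ {n} → Tri → Fin n → Tri
constRow x _ = x

zeroFirst : ∀ {n} → Tri → Fin n → Tri
zeroFirst x j = if toℕ j ≡ᵇ 0 then zer else x

zeroLast : ∀ {n} → Tri → Fin n → Tri
zeroLast {n} x j = if suc (toℕ j) ≡ᵇ n then zer else x

RowIs : ∀ {n} → (Fin n → Tri) → (Fin n → Tri) → Set
RowIs r s = ∀ j → r j ≡ s j

Invariant : ∀ {m n} → (Tri → Fin n → Tri) → Matrix m n → Matrix m n → Matrix m n → Set
Invariant {m} z A B C =
  (∀ i → RowIs (A i) (z pos) ⊎ RowIs (A i) (constRow pos) ⊎ RowIs (A i) (z neg) ⊎ RowIs (A i) (constRow neg)) ×
  (∀ i → RowIs (B i) (constRow pos) ⊎ RowIs (B i) (constRow neg)) ×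
  (∀ i → RowIs (C i) (constRow pos) ⊎ RowIs (C i) (constRow neg)) ×
  ((∃[ i ] RowIs (A i) (z pos)) → Compat B) ×
  ((∃[ i ] RowIs (A i) (z neg)) → Compat C)
  where
  Compat : Matrix m _ → Set
  Compat D = ∀ i →
    ((RowIs (A i) (z pos) ⊎ RowIs (A i) (constRow pos)) → RowIs (D i) (constRow pos)) ×
    ((RowIs (A i) (z neg) ⊎ RowIs (A i) (constRow neg)) → RowIs (D i) (constRow neg))

Left0Invariant : ∀ {m n} → Matrix m n → Matrix m n → Matrix m n → Set
Left0Invariant = Invariant zeroFirst

Right0Invariant : ∀ {m n} → Matrix m n → Matrix m n → Matrix m n → Set
Right0Invariant = Invariant zeroLast

-- Call a row an interval row if its nonzero entries share one sign and occupy an interval of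
-- columns.  If every row of M is an interval row, G_o(M) is semi-transitive: with height j+1
-- for column j, n+1 for rows of sign 1 and 0 for rows of sign -1, every edge goes up, so the
-- interior vertices of a path are columns in increasing order.  A chord u₀ → u_t then yields
-- every u_i → u_j, since a row endpoint is adjacent to an interval of columns containing its
-- neighbour on the path and the other endpoint.
-- Under left- (right-) 0-invariance every row of M^k is x^N or 0x^(N-1) (x^(N-1)0) with
-- x = ±1, where 0x^(N-1) (x^(N-1)0) occurs only if it is also a row of A, so that the
-- compatibility conditions on B and C apply.  These shapes reproduce under φ because an
-- index of a block product is first (last) exactly when both of its components are.
module Submission where

open import Defs
open import Data.Nat using (ℕ; zero; suc; _*_; _+_; _≤_; _<_; z≤n; s≤s; z<s; s≤s⁻¹; s<s⁻¹; _≡ᵇ_)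
open import Data.Nat.Properties
  using (≤-refl; ≤-trans; ≤-antisym; <-trans; <-irrefl; <⇒≤; ≤-<-trans; <-≤-trans; m≤n⇒m<n∨m≡n;
         m≤n⇒m≤1+n; n≤0⇒n≡0; +-comm; +-suc; *-comm; *-suc; *-zeroʳ; +-monoʳ-≤; *-monoʳ-≤;
         +-cancelˡ-≡; *-cancelˡ-≡; ≡ᵇ⇒≡; ≡⇒≡ᵇ; module ≤-Reasoning)
open import Data.Fin using (Fin; zero; suc; toℕ; inject₁; fromℕ; remQuot; combine)
  renaming (_<_ to _<ᶠ_; _≤_ to _≤ᶠ_)
open import Data.Fin.Properties
  using (toℕ<n; toℕ-injective; toℕ-inject₁; toℕ-combine; combine-remQuot; ≤fromℕ; ≤̄⇒inject₁<)
  renaming (_<?_ to _<ᶠ?_)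
open import Data.Fin.Relation.Unary.Top using (view; ‵fromℕ; ‵inj₁; ‵inject₁)
open import Data.Bool using (Bool; true; false; if_then_else_; _∧_; T)
open import Data.Bool.Properties using (T-∧; if-eta)
open import Data.Unit using (tt)
open import Data.Sum using (_⊎_; inj₁; inj₂; [_,_])
open import Data.Product using (_×_; _,_; ∃-syntax; proj₁; proj₂)
open import Data.Empty using (⊥; ⊥-elim)
open import Function.Bundles using (Equivalence)
open import Relation.Nullary using (¬_; Dec; yes; no)
open import Relation.Nullary.Decidable using (map′)
open import Relation.Binary.Definitions using (DecidableEquality)
open import Relation.Binary.PropositionalEquality using (_≡_; _≢_; refl; sym; trans; cong; subst; module ≡-Reasoning)

_≟_ : DecidableEquality Tri
neg ≟ neg = yes refl
zer ≟ zer = yes refl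
pos ≟ pos = yes refl
neg ≟ zer = no λ ()
neg ≟ pos = no λ ()
zer ≟ neg = no λ ()
zer ≟ pos = no λ ()
pos ≟ neg = no λ ()
pos ≟ zer = no λ ()

data Sign : Set where
  plus minus : Sign

⟦_⟧ : Sign → Tri
⟦ plus ⟧ = pos
⟦ minus ⟧ = neg

⟦⟧-injective : ∀ {s t} → ⟦ s ⟧ ≡ ⟦ t ⟧ → s ≡ t
⟦⟧-injective {plus} {plus} _ = refl
⟦⟧-injective {minus} {minus} _ = refl

⟦⟧≢zer : ∀ {s} → ⟦ s ⟧ ≢ zer
⟦⟧≢zer {plus} ()
⟦⟧≢zer {minus} ()

record IntervalRow {n} (row : Fin n → Tri) : Set where
  field
    sign     : Sign
    entries  : ∀ j → row j ≡ ⟦ sign ⟧ ⊎ row j ≡ zer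
    interval : ∀ {a b c} → row a ≡ ⟦ sign ⟧ → row c ≡ ⟦ sign ⟧ → a ≤ᶠ b → b ≤ᶠ c → row b ≡ ⟦ sign ⟧

  sign-unique : ∀ {j s} → row j ≡ ⟦ s ⟧ → sign ≡ s
  sign-unique {j} e with entries j
  ... | inj₁ e′ = ⟦⟧-injective (trans (sym e′) e)
  ... | inj₂ e′ = ⊥-elim (⟦⟧≢zer (trans (sym e) e′))

  interval-at : ∀ {a b c s} → row a ≡ ⟦ s ⟧ → row c ≡ ⟦ s ⟧ → a ≤ᶠ b → b ≤ᶠ c → row b ≡ ⟦ s ⟧
  interval-at ea ec ab bc with sign-unique ea
  ... | refl = interval ea ec ab bc

module _ {V : Set} {E : V → V → Set} (height : V → ℕ) (height-< : ∀ {v w} → E v w → height v < height w) where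

  walk-height-< : ∀ {n} {u : Fin (suc n) → V} → (∀ i → E (u (inject₁ i)) (u (suc i))) →
                  ∀ {i j} → i <ᶠ j → height (u i) < height (u j)
  walk-height-< {zero} _ {zero} {zero} ()
  walk-height-< {suc n} walk {zero} {suc zero} _ = height-< (walk zero)
  walk-height-< {suc n} {u} walk {zero} {suc (suc j)} _ =
    <-trans (height-< (walk zero)) (walk-height-< {u = λ x → u (suc x)} (λ i → walk (suc i)) {zero} {suc j} z<s)
  walk-height-< {suc n} {u} walk {suc i} {suc j} i<j =
    walk-height-< {u = λ x → u (suc x)} (λ i → walk (suc i)) (s<s⁻¹ i<j)

  walk-height-≤ : ∀ {n} {u : Fin (suc n) → V} → (∀ i → E (u (inject₁ i)) (u (suc i))) →
                  ∀ {i j} → i ≤ᶠ j → height (u i) ≤ height (u j)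
  walk-height-≤ walk i≤j with m≤n⇒m<n∨m≡n i≤j
  ... | inj₁ i<j = <⇒≤ (walk-height-< walk i<j)
  ... | inj₂ i≡j rewrite toℕ-injective i≡j = ≤-refl

  height⇒acyclic : Acyclic E
  height⇒acyclic k u path u₀≡uₜ =
    <-irrefl (cong height u₀≡uₜ) (walk-height-< {u = u} path {zero} {fromℕ (suc k)} z<s)

<fromℕ⇒≤inject₁ : ∀ {n} {i : Fin (suc (suc n))} → i <ᶠ fromℕ (suc n) → i ≤ᶠ inject₁ (fromℕ n)
<fromℕ⇒≤inject₁ {n} {i} i<last = subst (toℕ i ≤_) (sym (toℕ-inject₁ (fromℕ n))) (s≤s⁻¹ i<last)

module _ {m n} (M : Matrix m n) (rows : ∀ p → IntervalRow (M p)) where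
  open IntervalRow

  private
    E : Vertex m n → Vertex m n → Set
    E = GoEdge M

  rowHeight : Sign → ℕ
  rowHeight plus = suc n
  rowHeight minus = 0

  height : Vertex m n → ℕ
  height (inj₁ j) = suc (toℕ j)
  height (inj₂ p) = rowHeight (sign (rows p))

  height-< : ∀ {v w} → E v w → height v < height w
  height-< (colEdge j<i) = s≤s j<i
  height-< (upEdge {p} {j} e) rewrite sign-unique (rows p) {s = plus} e = s≤s (toℕ<n j)
  height-< (downEdge {p} e) rewrite sign-unique (rows p) {s = minus} e = z<s

  height-≤ : ∀ v → height v ≤ suc n
  height-≤ (inj₁ j) = m≤n⇒m≤1+n (toℕ<n j)
  height-≤ (inj₂ p) with sign (rows p)
  ... | plus = ≤-refl
  ... | minus = z≤n

  row-above-columns : ∀ p → 0 < height (inj₂ p) → n < height (inj₂ p)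
  row-above-columns p _ with sign (rows p)
  row-above-columns p _ | plus = ≤-refl
  row-above-columns p () | minus

  row-not-between : ∀ {v w p} → height v < height (inj₂ p) → height (inj₂ p) < height w → ⊥
  row-not-between {v} {w} {p} vp pw =
    <-irrefl refl (≤-trans (≤-trans (s≤s (row-above-columns p (≤-<-trans z≤n vp))) pw) (height-≤ w))

  between-columns : ∀ {v x y w} → height v < height x → height x < height y → height y < height w → E x y
  between-columns {x = inj₁ a} {y = inj₁ b} _ xy _ = colEdge (s<s⁻¹ xy)
  between-columns {v} {y = inj₂ q} {w} vx xy yw = ⊥-elim (row-not-between {v} {w} (<-trans vx xy) yw)
  between-columns {v} {x = inj₂ p} {w = w} vx xy yw = ⊥-elim (row-not-between {v} {w} vx (<-trans xy yw))

  -- v₁ is the successor of v on the path and w its last vertex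
  out-shortcut : ∀ {v v₁ y w} → E v v₁ → E v w → height v₁ ≤ height y → height y < height w → E v y
  out-shortcut {inj₁ a} {y = inj₁ b} e₁ _ v₁y _ = colEdge (s≤s⁻¹ (<-≤-trans (height-< e₁) v₁y))
  out-shortcut {inj₂ p} {y = inj₁ b} (downEdge e₁) (downEdge e) v₁y yw =
    downEdge (interval-at (rows p) e₁ e (s≤s⁻¹ v₁y) (<⇒≤ (s<s⁻¹ yw)))
  out-shortcut {v} {y = inj₂ q} {w} e₁ _ v₁y yw =
    ⊥-elim (row-not-between {v} {w} (<-≤-trans (height-< e₁) v₁y) yw)

  -- v is the first vertex of the path and w₁ the predecessor of w
  in-shortcut : ∀ {v w w₁ x} → E v w → E w₁ w → height v < height x → height x ≤ height w₁ → E x w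
  in-shortcut {w = inj₁ c} {x = inj₁ b} _ e₁ _ xw₁ = colEdge (s<s⁻¹ (≤-<-trans xw₁ (height-< e₁)))
  in-shortcut {w = inj₂ q} {x = inj₁ b} (upEdge e) (upEdge e₁) vx xw₁ =
    upEdge (interval-at (rows q) e e₁ (<⇒≤ (s<s⁻¹ vx)) (s≤s⁻¹ xw₁))
  in-shortcut {v} {w} {x = inj₂ p} _ e₁ vx xw₁ =
    ⊥-elim (row-not-between {v} {w} vx (≤-<-trans xw₁ (height-< e₁)))

  path-height-< : ∀ {k} u → IsPath E k u → ∀ {i j} → i <ᶠ j → height (u i) < height (u j)
  path-height-< u = walk-height-< height (λ {v} {w} → height-< {v} {w}) {u = u}

  path-height-≤ : ∀ {k} u → IsPath E k u → ∀ {i j} → i ≤ᶠ j → height (u i) ≤ height (u j)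
  path-height-≤ u = walk-height-≤ height (λ {v} {w} → height-< {v} {w}) {u = u}

  chord⇒transitive : ∀ {k u} → IsPath E k u → E (u zero) (u (fromℕ (suc k))) →
                     ∀ i j → i <ᶠ j → E (u i) (u j)
  chord⇒transitive {k} {u} path chord i j i<j with view j
  chord⇒transitive path chord zero _ _ | ‵fromℕ = chord
  chord⇒transitive {k} {u} path chord (suc i) _ i<last | ‵fromℕ =
    in-shortcut chord (path (fromℕ k)) (path-height-< u path z<s)
      (path-height-≤ u path (<fromℕ⇒≤inject₁ i<last))
  chord⇒transitive {u = u} path chord zero _ 0<j | ‵inject₁ j =
    out-shortcut (path zero) chord (path-height-≤ u path 0<j)
      (path-height-< u path (≤̄⇒inject₁< (≤fromℕ j)))
  chord⇒transitive {k} {u} path chord (suc i) _ i<j | ‵inject₁ j =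
    between-columns {u zero} {w = u (fromℕ (suc k))} (path-height-< u path z<s) (path-height-< u path i<j)
      (path-height-< u path (≤̄⇒inject₁< (≤fromℕ j)))

  edge? : ∀ v w → Dec (E v w)
  edge? (inj₁ a) (inj₁ b) = map′ colEdge (λ { (colEdge a<b) → a<b }) (a <ᶠ? b)
  edge? (inj₁ a) (inj₂ p) = map′ upEdge (λ { (upEdge e) → e }) (M p a ≟ pos)
  edge? (inj₂ p) (inj₁ a) = map′ downEdge (λ { (downEdge e) → e }) (M p a ≟ neg)
  edge? (inj₂ p) (inj₂ q) = no λ ()

  intervalRows⇒semiTransitive : SemiTransitive E
  intervalRows⇒semiTransitive = height⇒acyclic height (λ {v} {w} → height-< {v} {w}) , chord-or-transitive
    where
    chord-or-transitive : ∀ k u → IsPath E k u →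
                          ¬ E (u zero) (u (fromℕ (suc k))) ⊎ (∀ i j → i <ᶠ j → E (u i) (u j))
    chord-or-transitive k u path with edge? (u zero) (u (fromℕ (suc k)))
    ... | yes chord = inj₂ (chord⇒transitive {u = u} path chord)
    ... | no ¬chord = inj₁ ¬chord

φ-entry : ∀ {m n p q} (A B C : Matrix m n) (M : Matrix p q) r c →
          φ A B C M r c ≡ block A B C (M (proj₁ (remQuot {p} m r)) (proj₁ (remQuot {q} n c)))
                                      (proj₂ (remQuot {p} m r)) (proj₂ (remQuot {q} n c))
φ-entry {m} {n} {p} {q} A B C M r c with remQuot {p} m r | remQuot {q} n c
... | r₁ , r₂ | c₁ , c₂ = refl

φ-row : ∀ {m n p q} (A B C : Matrix m n) (M : Matrix p q) (r : Fin (p * m)) (f : Fin (q * n) → Tri) →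
        (∀ c₁ c₂ → block A B C (M (proj₁ (remQuot {p} m r)) c₁) (proj₂ (remQuot {p} m r)) c₂
                   ≡ f (combine c₁ c₂)) →
        RowIs (φ A B C M r) f
φ-row {n = n} {q = q} A B C M r f entry c =
  trans (φ-entry A B C M r c) (trans (entry _ _) (cong f (combine-remQuot {q} n c)))

record ZeroPattern : Set where
  field
    marked          : ∀ {n} → Fin n → Bool
    marked-single   : marked {1} zero ≡ true
    marked-combine  : ∀ {p q} (i : Fin p) (j : Fin q) → marked (combine i j) ≡ marked i ∧ marked j
    unmarked-convex : ∀ {n} {a b c : Fin n} → ¬ T (marked a) → ¬ T (marked c) → a ≤ᶠ b → b ≤ᶠ c → ¬ T (marked b)

  zeroRow : ∀ {n} → Tri → Fin n → Tri
  zeroRow x j = if marked j then zer else x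

  zeroRow-combine : ∀ {p q} x (i : Fin p) (j : Fin q) →
                    zeroRow x (combine i j) ≡ (if marked i then zeroRow x j else x)
  zeroRow-combine x i j rewrite marked-combine i j with marked i
  ... | true = refl
  ... | false = refl

  block-zeroRow : ∀ {m n p} (A B C : Matrix m n) s (c₁ : Fin p) r c →
                  block A B C (zeroRow ⟦ s ⟧ c₁) r c ≡ (if marked c₁ then A r c else block A B C ⟦ s ⟧ r c)
  block-zeroRow A B C s c₁ r c with marked c₁
  ... | true = refl
  ... | false = refl

  zeroRow-unmarked : ∀ {n} {x} {j : Fin n} → ¬ T (marked j) → zeroRow x j ≡ x
  zeroRow-unmarked {j = j} ¬marked with marked j
  ... | true = ⊥-elim (¬marked tt)
  ... | false = refl

  zeroRow≡sign⇒unmarked : ∀ {n s} {j : Fin n} → zeroRow ⟦ s ⟧ j ≡ ⟦ s ⟧ → ¬ T (marked j)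
  zeroRow≡sign⇒unmarked {j = j} e with marked j
  ... | true = λ _ → ⟦⟧≢zer (sym e)
  ... | false = λ ()

  uniform-intervalRow : ∀ {n s} {row : Fin n → Tri} → RowIs row (constRow ⟦ s ⟧) → IntervalRow row
  uniform-intervalRow {s = s} row≡ = record
    { sign = s ; entries = λ j → inj₁ (row≡ j) ; interval = λ _ _ _ _ → row≡ _ }

  punctured-intervalRow : ∀ {n s} {row : Fin n → Tri} → RowIs row (zeroRow ⟦ s ⟧) → IntervalRow row
  punctured-intervalRow {s = s} {row} row≡ = record { sign = s ; entries = entries ; interval = interval }
    where
    entries : ∀ j → row j ≡ ⟦ s ⟧ ⊎ row j ≡ zer
    entries j with marked j | row≡ j
    ... | true | e = inj₂ e
    ... | false | e = inj₁ e

    unmarked : ∀ {j} → row j ≡ ⟦ s ⟧ → ¬ T (marked j)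
    unmarked {j} e = zeroRow≡sign⇒unmarked (trans (sym (row≡ j)) e)

    interval : ∀ {a b c} → row a ≡ ⟦ s ⟧ → row c ≡ ⟦ s ⟧ → a ≤ᶠ b → b ≤ᶠ c → row b ≡ ⟦ s ⟧
    interval {b = b} ea ec ab bc =
      trans (row≡ b) (zeroRow-unmarked (unmarked-convex (unmarked ea) (unmarked ec) ab bc))

  module Iteration {m n} (A B C : Matrix m n) (inv : Invariant zeroRow A B C) where

    HasPuncturedRow : Sign → Set
    HasPuncturedRow s = ∃[ i ] RowIs (A i) (zeroRow ⟦ s ⟧)

    data RowShape {q} (row : Fin q → Tri) : Set where
      uniform   : ∀ s → RowIs row (constRow ⟦ s ⟧) → RowShape row
      punctured : ∀ s → HasPuncturedRow s → RowIs row (zeroRow ⟦ s ⟧) → RowShape row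

    rowShape⇒intervalRow : ∀ {q} {row : Fin q → Tri} → RowShape row → IntervalRow row
    rowShape⇒intervalRow (uniform _ row≡) = uniform-intervalRow row≡
    rowShape⇒intervalRow (punctured _ _ row≡) = punctured-intervalRow row≡

    A-rowShape : ∀ i → RowShape (A i)
    A-rowShape i with proj₁ inv i
    ... | inj₁ z = punctured plus (i , z) z
    ... | inj₂ (inj₁ c) = uniform plus c
    ... | inj₂ (inj₂ (inj₁ z)) = punctured minus (i , z) z
    ... | inj₂ (inj₂ (inj₂ c)) = uniform minus c

    block-uniform : ∀ s r → ∃[ t ] RowIs (block A B C ⟦ s ⟧ r) (constRow ⟦ t ⟧)
    block-uniform plus r = [ (plus ,_) , (minus ,_) ] (proj₁ (proj₂ inv) r)
    block-uniform minus r = [ (plus ,_) , (minus ,_) ] (proj₁ (proj₂ (proj₂ inv)) r)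

    block-compatible : ∀ s → HasPuncturedRow s → ∀ r t →
                       RowIs (A r) (zeroRow ⟦ t ⟧) ⊎ RowIs (A r) (constRow ⟦ t ⟧) →
                       RowIs (block A B C ⟦ s ⟧ r) (constRow ⟦ t ⟧)
    block-compatible plus w r plus = proj₁ (proj₁ (proj₂ (proj₂ (proj₂ inv))) w r)
    block-compatible plus w r minus = proj₂ (proj₁ (proj₂ (proj₂ (proj₂ inv))) w r)
    block-compatible minus w r plus = proj₁ (proj₂ (proj₂ (proj₂ (proj₂ inv))) w r)
    block-compatible minus w r minus = proj₂ (proj₂ (proj₂ (proj₂ (proj₂ inv))) w r)

    zeroMat-rowShape : HasZero A → ∀ r → RowShape (zeroMat r)
    zeroMat-rowShape (i , j , Aij≡0) r with A-rowShape i
    ... | uniform s Ai≡ = ⊥-elim (⟦⟧≢zer (trans (sym (Ai≡ j)) Aij≡0))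
    ... | punctured s w _ = punctured s w λ { zero → sym (cong (if_then zer else ⟦ s ⟧) marked-single) }

    block-under-uniform : ∀ {q s} {row : Fin q → Tri} → RowIs row (constRow ⟦ s ⟧) → ∀ r →
                          ∃[ t ] (∀ c₁ c₂ → block A B C (row c₁) r c₂ ≡ ⟦ t ⟧)
    block-under-uniform {s = s} row≡ r =
      proj₁ (block-uniform s r) , λ c₁ c₂ →
        trans (cong (λ x → block A B C x r c₂) (row≡ c₁)) (proj₂ (block-uniform s r) c₂)

    block-under-punctured : ∀ {q s t} {row : Fin q → Tri} → RowIs row (zeroRow ⟦ s ⟧) → HasPuncturedRow s →
                            ∀ {r} → RowIs (A r) (zeroRow ⟦ t ⟧) ⊎ RowIs (A r) (constRow ⟦ t ⟧) →
                            ∀ c₁ c₂ → block A B C (row c₁) r c₂ ≡ (if marked c₁ then A r c₂ else ⟦ t ⟧)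
    block-under-punctured {s = s} {t} {row} row≡ w {r} Ar c₁ c₂ = begin
      block A B C (row c₁) r c₂
        ≡⟨ cong (λ x → block A B C x r c₂) (row≡ c₁) ⟩
      block A B C (zeroRow ⟦ s ⟧ c₁) r c₂
        ≡⟨ block-zeroRow A B C s c₁ r c₂ ⟩
      (if marked c₁ then A r c₂ else block A B C ⟦ s ⟧ r c₂)
        ≡⟨ cong (if marked c₁ then A r c₂ else_) (block-compatible s w r t Ar c₂) ⟩
      (if marked c₁ then A r c₂ else ⟦ t ⟧)
        ∎
      where open ≡-Reasoning

    φ-rowShape : ∀ {p q} (M : Matrix p q) → (∀ r → RowShape (M r)) → ∀ r → RowShape (φ A B C M r)
    φ-rowShape {p} M shapes r with shapes (proj₁ (remQuot {p} m r)) | A-rowShape (proj₂ (remQuot {p} m r))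
    ... | uniform s Mr₁≡ | _ with block-under-uniform Mr₁≡ (proj₂ (remQuot {p} m r))
    ...   | t , entry≡ = uniform t (φ-row A B C M r _ entry≡)
    φ-rowShape M shapes r | punctured s w Mr₁≡ | uniform t Ar₂≡ =
      uniform t (φ-row A B C M r _ λ c₁ c₂ →
        trans (block-under-punctured Mr₁≡ w (inj₂ Ar₂≡) c₁ c₂)
              (trans (cong (if marked c₁ then_else ⟦ t ⟧) (Ar₂≡ c₂)) (if-eta (marked c₁))))
    φ-rowShape M shapes r | punctured s w Mr₁≡ | punctured t w′ Ar₂≡ =
      punctured t w′ (φ-row A B C M r _ λ c₁ c₂ →
        trans (block-under-punctured Mr₁≡ w (inj₁ Ar₂≡) c₁ c₂)
              (trans (cong (if marked c₁ then_else ⟦ t ⟧) (Ar₂≡ c₂)) (sym (zeroRow-combine ⟦ t ⟧ c₁ c₂))))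

    Mpow-rowShape : HasZero A → ∀ k r → RowShape (Mpow A B C k r)
    Mpow-rowShape hasZero zero = zeroMat-rowShape hasZero
    Mpow-rowShape hasZero (suc k) = φ-rowShape (Mpow A B C k) (Mpow-rowShape hasZero k)

    invariant⇒ISTinfinite : HasZero A → ISTinfinite A B C
    invariant⇒ISTinfinite hasZero k =
      intervalRows⇒semiTransitive (Mpow A B C k) (λ r → rowShape⇒intervalRow (Mpow-rowShape hasZero k r))

isZero-combine : ∀ {p q} (i : Fin p) (j : Fin q) → (toℕ (combine i j) ≡ᵇ 0) ≡ (toℕ i ≡ᵇ 0) ∧ (toℕ j ≡ᵇ 0)
isZero-combine {q = zero} i ()
isZero-combine {q = suc q} i j rewrite toℕ-combine i j with toℕ i
... | zero rewrite *-zeroʳ q = refl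
... | suc a = refl

leftmost : ZeroPattern
leftmost = record
  { marked          = λ j → toℕ j ≡ᵇ 0
  ; marked-single   = refl
  ; marked-combine  = isZero-combine
  ; unmarked-convex = λ {_} {a} a≢0 _ a≤b _ b≡0 →
      a≢0 (≡⇒≡ᵇ (toℕ a) 0 (n≤0⇒n≡0 (subst (toℕ a ≤_) (≡ᵇ⇒≡ _ 0 b≡0) a≤b)))
  }

last-combine : ∀ {p q a b} → a < p → b < q → suc (q * a + b) ≡ p * q → suc a ≡ p × suc b ≡ q
last-combine {p} {suc q} {a} {b} a<p b<q last =
  *-cancelˡ-≡ (suc a) p (suc q) tight , +-cancelˡ-≡ (suc q * a) _ _ b-tight
  where
  open ≤-Reasoning
  tight : suc q * suc a ≡ suc q * p
  tight = ≤-antisym (*-monoʳ-≤ (suc q) a<p) (begin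
    suc q * p             ≡⟨ *-comm (suc q) p ⟩
    p * suc q             ≡⟨ sym last ⟩
    suc (suc q * a + b)   ≡⟨ sym (+-suc _ b) ⟩
    suc q * a + suc b     ≤⟨ +-monoʳ-≤ (suc q * a) b<q ⟩
    suc q * a + suc q     ≡⟨ +-comm _ (suc q) ⟩
    suc q + suc q * a     ≡⟨ sym (*-suc (suc q) a) ⟩
    suc q * suc a         ∎)
  b-tight : suc q * a + suc b ≡ suc q * a + suc q
  b-tight = begin-equality
    suc q * a + suc b     ≡⟨ +-suc _ b ⟩
    suc (suc q * a + b)   ≡⟨ last ⟩
    p * suc q             ≡⟨ *-comm p (suc q) ⟩
    suc q * p             ≡⟨ sym tight ⟩
    suc q * suc a         ≡⟨ *-suc (suc q) a ⟩
    suc q + suc q * a     ≡⟨ +-comm (suc q) _ ⟩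
    suc q * a + suc q     ∎

last-combine⁻¹ : ∀ {p q a b} → suc a ≡ p → suc b ≡ q → suc (q * a + b) ≡ p * q
last-combine⁻¹ {a = a} {b} refl refl = cong suc (trans (+-comm _ b) (cong (b +_) (*-comm (suc b) a)))

Bool-ext : ∀ {x y} → (T x → T y) → (T y → T x) → x ≡ y
Bool-ext {false} {false} _ _ = refl
Bool-ext {false} {true} _ y⇒x = ⊥-elim (y⇒x tt)
Bool-ext {true} {false} x⇒y _ = ⊥-elim (x⇒y tt)
Bool-ext {true} {true} _ _ = refl

isLast-combine : ∀ {p q} (i : Fin p) (j : Fin q) →
                 (suc (toℕ (combine i j)) ≡ᵇ p * q) ≡ (suc (toℕ i) ≡ᵇ p) ∧ (suc (toℕ j) ≡ᵇ q)
isLast-combine {p} {q} i j rewrite toℕ-combine i j = Bool-ext to from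
  where
  to : T (suc (q * toℕ i + toℕ j) ≡ᵇ p * q) → T ((suc (toℕ i) ≡ᵇ p) ∧ (suc (toℕ j) ≡ᵇ q))
  to last with last-combine (toℕ<n i) (toℕ<n j) (≡ᵇ⇒≡ _ _ last)
  ... | i-last , j-last = Equivalence.from T-∧ (≡⇒≡ᵇ _ _ i-last , ≡⇒≡ᵇ _ _ j-last)
  from : T ((suc (toℕ i) ≡ᵇ p) ∧ (suc (toℕ j) ≡ᵇ q)) → T (suc (q * toℕ i + toℕ j) ≡ᵇ p * q)
  from both with Equivalence.to T-∧ both
  ... | i-last , j-last =
    ≡⇒≡ᵇ _ (p * q) (last-combine⁻¹ (≡ᵇ⇒≡ (suc (toℕ i)) p i-last) (≡ᵇ⇒≡ (suc (toℕ j)) q j-last))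

rightmost : ZeroPattern
rightmost = record
  { marked          = λ {n} j → suc (toℕ j) ≡ᵇ n
  ; marked-single   = refl
  ; marked-combine  = isLast-combine
  ; unmarked-convex = λ {_} {_} {b} {c} _ c≢last _ b≤c b-last →
      c≢last (≡⇒≡ᵇ _ _ (≤-antisym (toℕ<n c)
        (subst (_≤ suc (toℕ c)) (≡ᵇ⇒≡ (suc (toℕ b)) _ b-last) (s≤s b≤c))))
  }

lemma3p23 : {m n : ℕ} (A B C : Matrix m n) → HasZero A →
            Left0Invariant A B C ⊎ Right0Invariant A B C → ISTinfinite A B C
lemma3p23 A B C hasZero (inj₁ left) = ZeroPattern.Iteration.invariant⇒ISTinfinite leftmost A B C left hasZero
lemma3p23 A B C hasZero (inj₂ right) = ZeroPattern.Iteration.invariant⇒ISTinfinite rightmost A B C right hasZero
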